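{- Suppose $T_0,T_1,T_2,\dots$ are trees in $\mathbf{LT}$ with $T_{n+1}\subseteq_{n+1}T_n$ for all $n$. Then (i) $T=\bigcap_nT_n\in\mathbf{LT}$; (ii) if $n<\omega$ and $s\in 2^{n+1}$ then $T(\to s)=T\cap T_n(\to s)=\bigcap_{m\ge n}T_m(\to s)$.
   Context: $T{\restriction}s=\{t\in T:s\subseteq t\lor t\subseteq s\}$ for $T\subseteq 2^{<\omega}$. The stem of a perfect tree $T$ is the largest $s\in T$ with $T=T{\restriction}s$. $\mathbf{LT}$ is the set of perfect trees $T\subseteq 2^{<\omega}$ for which there are nonempty strings $q^m_i$ ($m<\omega,i<2$) with $\mathrm{lh}(q^m_0)=\mathrm{lh}(q^m_1)$, $q^m_i(0)=i$, such that $T$ consists of all initial segments of strings $\mathrm{stem}(T)^\frown q^0_{i(0)}{}^\frown\cdots{}^\frown q^m_{i(m)}$. $\mathrm{spl}_0(T)=\mathrm{lh}(\mathrm{stem}(T))$, $\mathrm{spl}_{m+1}(T)=\mathrm{spl}_m(T)+\mathrm{lh}(q^m_0)$. For $T\in\mathbf{LT}$: $T(\to i)=T{\restriction}(\mathrm{stem}(T)^\frown i)$, and for $s\in 2^m$, $T(\to s)=(\cdots(T(\to s(0)))\cdots)(\to s(m-1))$. $S\subseteq_n T$ means $S\subseteq T$ and $\mathrm{spl}_k(S)=\mathrm{spl}_k(T)$ for all $k<n$. -}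

module Defs where

open import Level using (0ℓ)
open import Data.Bool using (Bool; false; true)
open import Data.List using (List; []; _∷_; _++_; _∷ʳ_; length)
open import Data.Vec using (Vec; []; _∷_)
open import Data.Nat using (ℕ; zero; suc; _+_; _<_; _≤_)
open import Data.Product using (Σ; ∃; _×_; _,_)
open import Data.Sum using (_⊎_)
open import Relation.Unary using (Pred; _⊆_; _≐_; _∩_)
open import Relation.Binary.PropositionalEquality using (_≡_)

-- binary strings (elements of 2^{<ω}); false = 0, true = 1
Str : Set
Str = List Bool

Tree : Set₁
Tree = Pred Str 0ℓ

_⊑_ : Str → Str → Set
s ⊑ t = ∃ λ u → s ++ u ≡ t

_↾_ : Tree → Str → Tree
(T ↾ s) t = T t × (s ⊑ t ⊎ t ⊑ s)

-- The data witnessing membership in LT: the stem and the strings q^m_i.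
record LTData : Set where
  field
    stem : Str
    q    : ℕ → Bool → Str
    q-head : ∀ m i → ∃ λ r → q m i ≡ i ∷ r
    q-len  : ∀ m → length (q m false) ≡ length (q m true)
open LTData public

path : (ℕ → Bool → Str) → ∀ {m} → Vec Bool m → Str
path q []      = []
path q (b ∷ c) = q zero b ++ path (λ k → q (suc k)) c

⟦_⟧ : LTData → Tree
⟦ D ⟧ t = Σ ℕ λ m → Σ (Vec Bool m) λ c → t ⊑ (stem D ++ path (q D) c)

IsLT : Tree → Set
IsLT T = Σ LTData λ D → T ≐ ⟦ D ⟧

spl : ℕ → LTData → ℕ
spl zero    D = length (stem D)
spl (suc k) D = spl k D + length (q D k false)

-- S ⊆_n T (splitting levels read off from the LT data of S and T)
SubN : ℕ → (S T : Tree) → LTData → LTData → Set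
SubN n S T DS DT = S ⊆ T × (∀ k → k < n → spl k DS ≡ spl k DT)

-- LT data of T(→i) = T↾(stem(T)⌢i): stem becomes stem(T)⌢q^0_i, the q's shift
step : LTData → Bool → LTData
step D i = record
  { stem   = stem D ++ q D zero i
  ; q      = λ m → q D (suc m)
  ; q-head = λ m → q-head D (suc m)
  ; q-len  = λ m → q-len D (suc m)
  }

to1 : LTData → Bool → Tree
to1 D i = ⟦ D ⟧ ↾ (stem D ∷ʳ i)

to : LTData → ∀ {n} → Vec Bool (suc n) → Tree
to D (i ∷ [])    = to1 D i
to D (i ∷ j ∷ s) = to (step D i) (j ∷ s)

module Submission where

-- If S ⊆ T are LT-trees with spl_k(S) = spl_k(T) for k ≤ n, then S and
-- T have the same stem and the same splitting strings q^k_i for k < n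
-- ('spl-agree'): comparing lengths of members pins down the stem, and the
-- member stem⌢q^0_i of S(→i) ⊆ T(→i) pins down q^0_i; iterating through
-- T(→false) handles the deeper levels.  Along the sequence T_n the strings
-- q^k_i are therefore frozen from stage k+1 on, and the fused data
-- E = (stem(T_0), q^k_i(T_{k+1})) agrees with T_m below level m.

open import Defs
open import Data.Nat using (ℕ; zero; suc; _+_; _∸_; _≤_; _<_; z≤n; s≤s; _≤?_; _≤′_; ≤′-refl; ≤′-step)
open import Data.Nat.Properties
open import Data.Vec using (Vec; []; _∷_)
open import Data.Bool using (Bool; false; true)
open import Data.List using ([]; _∷_; _++_; _∷ʳ_; length)
open import Data.List.Properties using (∷-injective; length-++; length-++-≤ˡ; ++-assoc; ++-identityʳ; ++-cancelˡ; ∷ʳ-injectiveʳ)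
open import Data.Product using (Σ; _×_; _,_; proj₁; proj₂)
open import Data.Sum using (_⊎_; inj₁; inj₂)
open import Data.Empty using (⊥-elim)
open import Relation.Nullary using (yes; no)
open import Relation.Unary using (_⊆_; _≐_; _∩_)
open import Relation.Unary.Properties using (≐-sym; ≐-trans)
open import Function using (_∘_)
open import Relation.Binary.PropositionalEquality

⊑-extend : ∀ (a b : Str) → a ⊑ (a ++ b)
⊑-extend a b = b , refl

⊑-trans : ∀ {a b c} → a ⊑ b → b ⊑ c → a ⊑ c
⊑-trans {a} (u , refl) (v , refl) = u ++ v , sym (++-assoc a u v)

⊑-length : ∀ {a b} → a ⊑ b → length a ≤ length b
⊑-length {a} (u , refl) = length-++-≤ˡ a

⊑-by-length : ∀ a b {y} → a ⊑ y → b ⊑ y → length a ≤ length b → a ⊑ b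
⊑-by-length []      b       _         _       _       = b , refl
⊑-by-length (x ∷ a) []      _         _       ()
⊑-by-length (x ∷ a) (z ∷ b) (u , refl) (v , e) (s≤s l) with refl , e′ ← ∷-injective e
  with w , a++w≡b ← ⊑-by-length a b (u , refl) (v , e′) l = w , cong (x ∷_) a++w≡b

⊑-by-length-≡ : ∀ a b {y} → a ⊑ y → b ⊑ y → length a ≡ length b → a ≡ b
⊑-by-length-≡ []      []      _          _       _ = refl
⊑-by-length-≡ []      (z ∷ b) _          _       ()
⊑-by-length-≡ (x ∷ a) []      _          _       ()
⊑-by-length-≡ (x ∷ a) (z ∷ b) (u , refl) (v , e) l with refl , e′ ← ∷-injective e =
  cong (x ∷_) (⊑-by-length-≡ a b (u , refl) (v , e′) (suc-injective l))

⊑-comparable : ∀ a b {y} → a ⊑ y → b ⊑ y → a ⊑ b ⊎ b ⊑ a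
⊑-comparable a b a⊑y b⊑y with ≤-total (length a) (length b)
... | inj₁ a≤b = inj₁ (⊑-by-length a b a⊑y b⊑y a≤b)
... | inj₂ b≤a = inj₂ (⊑-by-length b a b⊑y a⊑y b≤a)

length-∷ʳ : ∀ (a : Str) i → length (a ∷ʳ i) ≡ suc (length a)
length-∷ʳ a i = trans (length-++ a) (+-comm (length a) 1)

q-length : ∀ X k i → length (q X k i) ≡ length (q X k false)
q-length X k false = refl
q-length X k true = sym (q-len X k)

q-nonempty : ∀ X k i → 1 ≤ length (q X k i)
q-nonempty X k i with r , e ← q-head X k i = subst (λ w → 1 ≤ length w) (sym e) (s≤s z≤n)

stem-∷ʳ-⊑ : ∀ X i → (stem X ∷ʳ i) ⊑ (stem X ++ q X zero i)
stem-∷ʳ-⊑ X i with r , e ← q-head X zero i =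
  r , trans (++-assoc (stem X) (i ∷ []) r) (cong (stem X ++_) (sym e))

spl-one : ∀ X i → length (stem X ++ q X zero i) ≡ spl 1 X
spl-one X i = trans (length-++ (stem X)) (cong (length (stem X) +_) (q-length X zero i))

spl-step : ∀ k X i → spl k (step X i) ≡ spl (suc k) X
spl-step zero    X i = spl-one X i
spl-step (suc k) X i = cong (_+ length (q X (suc k) false)) (spl-step k X i)

stem-unique : ∀ X {t} → ⟦ X ⟧ t → length t ≡ length (stem X) → t ≡ stem X
stem-unique X {t} (_ , _ , p) = ⊑-by-length-≡ t (stem X) p (⊑-extend (stem X) _)

step-⊆ : ∀ X i → ⟦ step X i ⟧ ⊆ ⟦ X ⟧
step-⊆ X i (m , c , p) = suc m , i ∷ c , subst (_ ⊑_) (++-assoc (stem X) (q X zero i) _) p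

-- The LT data 'step X i' describes T(→i) = T↾(stem⌢i): one inclusion ...
step⊆to1 : ∀ X i → ⟦ step X i ⟧ ⊆ to1 X i
step⊆to1 X i {t} h@(_ , _ , p) =
  step-⊆ X i h , ⊑-comparable (stem X ∷ʳ i) t (⊑-trans (stem-∷ʳ-⊑ X i) (⊑-extend _ _)) p

-- ... and the other: a member extending stem⌢i runs through the block q^0_i,
-- because the first bit of the first block is determined by the member.
to1⊆step : ∀ X i → to1 X i ⊆ ⟦ step X i ⟧
to1⊆step X i (_ , inj₂ t⊑s) = 0 , [] , ⊑-trans t⊑s (⊑-trans (stem-∷ʳ-⊑ X i) (⊑-extend _ []))
to1⊆step X i ((_ , [] , p) , inj₁ s⊑t) =
  ⊥-elim (1+n≰n (subst₂ _≤_ (length-∷ʳ (stem X) i) (cong length (++-identityʳ (stem X)))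
                   (⊑-length (⊑-trans s⊑t p))))
to1⊆step X i {t} ((_ , b ∷ c , p) , inj₁ s⊑t) = subst (λ j → ⟦ step X j ⟧ t) b≡i (_ , c , p′)
  where
    p′ : t ⊑ ((stem X ++ q X zero b) ++ path (q (step X b)) c)
    p′ = subst (t ⊑_) (sym (++-assoc (stem X) (q X zero b) _)) p
    b≡i : b ≡ i
    b≡i = ∷ʳ-injectiveʳ (stem X) (stem X)
      (⊑-by-length-≡ (stem X ∷ʳ b) (stem X ∷ʳ i) (⊑-trans (stem-∷ʳ-⊑ X b) (⊑-extend _ _))
        (⊑-trans s⊑t p′) (trans (length-∷ʳ (stem X) b) (sym (length-∷ʳ (stem X) i))))

to1-stem : ∀ X Y {t} i → stem X ≡ stem Y → ⟦ Y ⟧ t → to1 X i t → to1 Y i t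
to1-stem X Y {t} i e y (_ , c) = y , subst (λ s → (s ∷ʳ i) ⊑ t ⊎ t ⊑ (s ∷ʳ i)) e c

step-mono : ∀ X Y i → ⟦ X ⟧ ⊆ ⟦ Y ⟧ → stem X ≡ stem Y → ⟦ step X i ⟧ ⊆ ⟦ step Y i ⟧
step-mono X Y i sub e h = to1⊆step Y i (to1-stem X Y i e (sub (step-⊆ X i h)) (step⊆to1 X i h))

record Agree (n : ℕ) (X Y : LTData) : Set where
  constructor _,_
  field
    stem-≡ : stem X ≡ stem Y
    q-≡    : ∀ k → k < n → ∀ i → q X k i ≡ q Y k i
open Agree

Agree-refl : ∀ {n X} → Agree n X X
Agree-refl = refl , λ _ _ _ → refl

Agree-sym : ∀ {n X Y} → Agree n X Y → Agree n Y X
Agree-sym (es , eq) = sym es , λ k k<n i → sym (eq k k<n i)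

Agree-trans : ∀ {n X Y Z} → Agree n X Y → Agree n Y Z → Agree n X Z
Agree-trans (es , eq) (es′ , eq′) = trans es es′ , λ k k<n i → trans (eq k k<n i) (eq′ k k<n i)

Agree-weaken : ∀ {n m X Y} → n ≤ m → Agree m X Y → Agree n X Y
Agree-weaken n≤m (es , eq) = es , λ k k<n → eq k (≤-trans k<n n≤m)

Agree-step : ∀ {n X Y} i → Agree (suc n) X Y → Agree n (step X i) (step Y i)
Agree-step i (es , eq) = cong₂ _++_ es (eq 0 (s≤s z≤n) i) , λ k k<n → eq (suc k) (s≤s k<n)

Agree-branch : ∀ {n X Y} → Agree n X Y → (c : Vec Bool n)
  → stem X ++ path (q X) c ≡ stem Y ++ path (q Y) c
Agree-branch (es , _) [] = cong (_++ []) es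
Agree-branch {X = X} {Y} a (b ∷ c) = begin
  stem X ++ (q X zero b ++ path (q (step X b)) c)  ≡⟨ ++-assoc (stem X) _ _ ⟨
  stem (step X b) ++ path (q (step X b)) c         ≡⟨ Agree-branch (Agree-step b a) c ⟩
  stem (step Y b) ++ path (q (step Y b)) c         ≡⟨ ++-assoc (stem Y) _ _ ⟩
  stem Y ++ (q Y zero b ++ path (q (step Y b)) c)  ∎
  where open ≡-Reasoning

Agree-⟦⟧ : ∀ {n X Y t} → Agree n X Y → (c : Vec Bool n)
  → t ⊑ (stem X ++ path (q X) c) → ⟦ Y ⟧ t
Agree-⟦⟧ {t = t} a c p = _ , c , subst (t ⊑_) (Agree-branch a c) p

stem-agree : ∀ X Y → ⟦ X ⟧ ⊆ ⟦ Y ⟧ → spl 0 X ≡ spl 0 Y → stem X ≡ stem Y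
stem-agree X Y sub = stem-unique Y (sub (0 , [] , ⊑-extend (stem X) []))

-- ... and, if spl_1 agrees as well, the same first splitting strings: the
-- member stem⌢q^0_i of S(→i) ⊆ T(→i) has the length of the stem of T(→i).
first-split-agree : ∀ X Y → ⟦ X ⟧ ⊆ ⟦ Y ⟧ → stem X ≡ stem Y → spl 1 X ≡ spl 1 Y
  → ∀ i → q X zero i ≡ q Y zero i
first-split-agree X Y sub es e₁ i =
  ++-cancelˡ (stem Y) _ _ (trans (cong (_++ q X zero i) (sym es)) branch≡)
  where
    branch≡ : stem X ++ q X zero i ≡ stem Y ++ q Y zero i
    branch≡ = stem-unique (step Y i) (step-mono X Y i sub es (0 , [] , ⊑-extend _ []))
      (trans (spl-one X i) (trans e₁ (sym (spl-one Y i))))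

-- Equal spl_0,…,spl_{k+1} determine q^k_i, by descending into (→false).
split-agree : ∀ k X Y → ⟦ X ⟧ ⊆ ⟦ Y ⟧ → (∀ j → j ≤ suc k → spl j X ≡ spl j Y)
  → ∀ i → q X k i ≡ q Y k i
split-agree zero    X Y sub e =
  first-split-agree X Y sub (stem-agree X Y sub (e 0 z≤n)) (e 1 (s≤s z≤n))
split-agree (suc k) X Y sub e =
  split-agree k (step X false) (step Y false)
    (step-mono X Y false sub (stem-agree X Y sub (e 0 z≤n))) λ j j≤ →
    trans (spl-step j X false) (trans (e (suc j) (s≤s j≤)) (sym (spl-step j Y false)))

spl-agree : ∀ n X Y → ⟦ X ⟧ ⊆ ⟦ Y ⟧ → (∀ k → k ≤ n → spl k X ≡ spl k Y) → Agree n X Y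
spl-agree n X Y sub e =
  stem-agree X Y sub (e 0 z≤n) , λ k k<n → split-agree k X Y sub (λ j j≤ → e j (≤-trans j≤ k<n))

to-⊆ : ∀ X {n} (s : Vec Bool (suc n)) → to X s ⊆ ⟦ X ⟧
to-⊆ X (i ∷ [])    = proj₁
to-⊆ X (i ∷ j ∷ s) = step-⊆ X i ∘ to-⊆ (step X i) (j ∷ s)

to-restrict : ∀ {n} X Y → ⟦ X ⟧ ⊆ ⟦ Y ⟧ → Agree n X Y
  → (s : Vec Bool (suc n)) → to X s ≐ (⟦ X ⟧ ∩ to Y s)
to-restrict X Y sub (es , _) (i ∷ []) =
  (λ h → proj₁ h , to1-stem X Y i es (sub (proj₁ h)) h) ,
  (λ (x , y) → to1-stem Y X i (sym es) x y)
to-restrict X Y sub a@(es , _) (i ∷ j ∷ s) =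
  (λ h → let (x , y) = proj₁ IH h in step-⊆ X i x , y) ,
  (λ (x , y) → proj₂ IH (into-step x (to-⊆ (step Y i) (j ∷ s) y) , y))
  where
    IH : to (step X i) (j ∷ s) ≐ (⟦ step X i ⟧ ∩ to (step Y i) (j ∷ s))
    IH = to-restrict (step X i) (step Y i) (step-mono X Y i sub es) (Agree-step i a) (j ∷ s)
    into-step : ∀ {t} → ⟦ X ⟧ t → ⟦ step Y i ⟧ t → ⟦ step X i ⟧ t
    into-step x y = to1⊆step X i (to1-stem Y X i (sym es) x (step⊆to1 Y i y))

-- A branch that leaves t after passing d characters beyond the current stem
-- has passed at most d splittings, each block q^k_i being nonempty.
blocks-bound : ∀ {k d f} → 1 ≤ f → 0 < d → k ≤ d ∸ f → suc k ≤ d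
blocks-bound {d = suc d} {f = suc f} _ _ k≤ = s≤s (≤-trans k≤ (m∸n≤m d f))

short-branch : ∀ X {m} (c : Vec Bool m) {t} → t ⊑ (stem X ++ path (q X) c)
  → Σ ℕ λ k → Σ (Vec Bool k) λ c′ → k ≤ length t ∸ length (stem X) × t ⊑ (stem X ++ path (q X) c′)
short-branch X [] p = 0 , [] , z≤n , p
short-branch X (b ∷ c) {t} p with length t ≤? length (stem X)
... | yes t≤ = 0 , [] , z≤n , ⊑-trans (⊑-by-length t (stem X) p (⊑-extend _ _) t≤) (⊑-extend _ [])
... | no t≰
  with k , c′ , k≤ , p′ ← short-branch (step X b) c (subst (t ⊑_) (sym (++-assoc (stem X) _ _)) p) =
  suc k , b ∷ c′ , blocks-bound (q-nonempty X zero b) (m<n⇒0<n∸m (≰⇒> t≰)) k≤′ ,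
  subst (t ⊑_) (++-assoc (stem X) _ _) p′
  where
    k≤′ : k ≤ (length t ∸ length (stem X)) ∸ length (q X zero b)
    k≤′ = subst (k ≤_)
      (trans (cong (length t ∸_) (length-++ (stem X)))
             (sym (∸-+-assoc (length t) (length (stem X)) (length (q X zero b)))))
      k≤

module Fusion (D : ℕ → LTData)
  (nested    : ∀ n → ⟦ D (suc n) ⟧ ⊆ ⟦ D n ⟧)
  (spl-fixed : ∀ n k → k ≤ n → spl k (D (suc n)) ≡ spl k (D n)) where

  nested-chain : ∀ {n m} → n ≤′ m → ⟦ D m ⟧ ⊆ ⟦ D n ⟧
  nested-chain ≤′-refl     = λ h → h
  nested-chain (≤′-step p) = λ h → nested-chain p (nested _ h)

  agree-chain : ∀ {n m} → n ≤′ m → Agree n (D m) (D n)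
  agree-chain ≤′-refl             = Agree-refl
  agree-chain (≤′-step {m} n≤′m) =
    Agree-trans (Agree-weaken (≤′⇒≤ n≤′m) (spl-agree m (D (suc m)) (D m) (nested m) (spl-fixed m)))
                (agree-chain n≤′m)

  -- the limit: the stem of D 0, and q^k_i frozen from stage k+1 on
  fused : LTData
  fused = record
    { stem   = stem (D 0)
    ; q      = λ k → q (D (suc k)) k
    ; q-head = λ k → q-head (D (suc k)) k
    ; q-len  = λ k → q-len (D (suc k)) k
    }

  fused-agree : ∀ m → Agree m fused (D m)
  fused-agree m =
    sym (stem-≡ (agree-chain (≤⇒≤′ z≤n))) ,
    λ k k<m i → sym (q-≡ (agree-chain (≤⇒≤′ k<m)) k ≤-refl i)

  -- branches of the fusion through m splittings are branches of D (m + n)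
  fused-⊆ : ∀ n → ⟦ fused ⟧ ⊆ ⟦ D n ⟧
  fused-⊆ n (m , c , p) =
    nested-chain (≤⇒≤′ (m≤n+m n m)) (Agree-⟦⟧ (Agree-weaken (m≤m+n m n) (fused-agree (m + n))) c p)

  -- a member t of every D n lies on a branch of D (lh t) through at most lh t
  -- splittings, below which D (lh t) agrees with the fusion
  fused-⊇ : ∀ {t} → (∀ n → ⟦ D n ⟧ t) → ⟦ fused ⟧ t
  fused-⊇ {t} h with _ , c , p ← h (length t)
    with k , c′ , k≤ , p′ ← short-branch (D (length t)) c p =
    Agree-⟦⟧ (Agree-sym (Agree-weaken k≤lh (fused-agree (length t)))) c′ p′
    where
      k≤lh : k ≤ length t
      k≤lh = ≤-trans k≤ (m∸n≤m (length t) (length (stem (D (length t)))))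

  fused-to : ∀ {n m} → n ≤ m → (s : Vec Bool (suc n)) → to fused s ≐ (⟦ fused ⟧ ∩ to (D m) s)
  fused-to {m = m} n≤m = to-restrict fused (D m) (fused-⊆ m) (Agree-weaken n≤m (fused-agree m))

  fused-to-tail : ∀ n (s : Vec Bool (suc n)) → to fused s ≐ (λ t → ∀ m → n ≤ m → to (D m) s t)
  fused-to-tail n s =
    (λ h m n≤m → proj₂ (proj₁ (fused-to n≤m s) h)) ,
    (λ h → proj₂ (fused-to ≤-refl s) (fused-⊇ (λ j → in-D j (h (n + j) (m≤m+n n j))) , h n ≤-refl))
    where
      in-D : ∀ j {t} → to (D (n + j)) s t → ⟦ D j ⟧ t
      in-D j = nested-chain (≤⇒≤′ (m≤n+m j n)) ∘ to-⊆ (D (n + j)) s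

∩-congˡ : ∀ {A B C : Tree} → A ≐ B → (A ∩ C) ≐ (B ∩ C)
∩-congˡ (A⊆B , B⊆A) = (λ (a , c) → A⊆B a , c) , (λ (b , c) → B⊆A b , c)

lemma3p4 : (T : ℕ → Tree) (D : ℕ → LTData)
    → (∀ n → T n ≐ ⟦ D n ⟧)
    → (∀ n → SubN (suc n) (T (suc n)) (T n) (D (suc n)) (D n))
    → Σ LTData λ E → ((λ t → ∀ n → T n t) ≐ ⟦ E ⟧)
    × (∀ n (s : Vec Bool (suc n))
    → (to E s ≐ ((λ t → ∀ m → T m t) ∩ to (D n) s))
    × (to E s ≐ (λ t → ∀ m → n ≤ m → to (D m) s t)))
lemma3p4 T D T≐D sub = fused , ⋂T≐fused ,
  λ n s → ≐-trans (fused-to ≤-refl s) (∩-congˡ (≐-sym ⋂T≐fused)) , fused-to-tail n s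
  where
    nested : ∀ n → ⟦ D (suc n) ⟧ ⊆ ⟦ D n ⟧
    nested n = proj₁ (T≐D n) ∘ proj₁ (sub n) ∘ proj₂ (T≐D (suc n))
    open Fusion D nested (λ n k k≤n → proj₂ (sub n) k (s≤s k≤n))
    ⋂T≐fused : (λ t → ∀ n → T n t) ≐ ⟦ fused ⟧
    ⋂T≐fused = (λ h → fused-⊇ (λ n → proj₁ (T≐D n) (h n))) , (λ h n → proj₂ (T≐D n) (fused-⊆ n h))
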